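{- Let $(\delta,K_1,K_2,C_0,C_1)$ be admissible parameters satisfying Case III, let $M$ be a magic distance, and let $\mathbf C$ be a metric cycle of odd perimeter with distances $a,b,x_1,\dots,x_k$ such that $a+b>2K_2+\sum_{i=1}^kx_i$. If $\mathbf C$ has at least 4 vertices, then $\mathbf C$ has a tension.
   Context: A $\delta$-edge-labelled cycle is a cycle graph (at least 3 vertices) with edge labels in $\{1,\dots,\delta\}$; it "has distances $d_1,\dots,d_m$" if its edges can be listed in some (arbitrary) order with these labels; its perimeter is the sum of labels. It is non-metric if some label exceeds the sum of the other labels, metric otherwise. Two edges are neighbouring if they share a vertex. Parameters: integers with $3\le\delta<\infty$, $1\le K_1\le K_2\le\delta$, $2\delta+2\le C_0,C_1\le3\delta+2$, $C_0$ even, $C_1$ odd; $C=\min(C_0,C_1)$, $C'=\max(C_0,C_1)$. Case III (admissible) means: $C>2\delta+K_1$, $K_1+2K_2\ge2\delta-1$, $3K_2\ge2\delta$, if $K_1+2K_2=2\delta-1$ then $C\ge2\delta+K_1+2$, and if $C'>C+1$ then $C\ge2\delta+K_2$. Magic distance: $M\in\{1,\dots,\delta\}$ with $\max(K_1,\lceil\delta/2\rceil)\le M\le\min(K_2,\lfloor(C-\delta-1)/2\rfloor)$, such that moreover $M>K_1$ if $K_1+2K_2=2\delta-1$, and $M<K_2$ if $C'>C+1$ and $C=2\delta+K_2$. Operation: $x\oplus y=|x-y|$ if $|x-y|>M$; otherwise $\min(x+y,C-1-x-y)$ if this is $<M$; otherwise $M$. A cycle has a tension if it has neighbouring edges with labels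 $a,b$ such that $a\oplus b\ne M$. -}

module Defs where

open import Data.Nat using (ℕ; zero; suc; _+_; _*_; _∸_; _≤_; _<_; _>_; _≥_; _⊓_; _⊔_; _%_; ∣_-_∣; ⌈_/2⌉; ⌊_/2⌋; _<?_)
open import Data.Bool using (if_then_else_)
open import Data.Fin using (Fin; toℕ)
open import Data.Vec using (Vec; lookup; toList)
open import Data.List using (List; _∷_)
open import Data.Nat.ListAction using (sum)
open import Data.List.Relation.Binary.Permutation.Propositional using (_↭_)
open import Data.Product using (_×_; Σ; ∃; ∃-syntax)
open import Data.Sum using (_⊎_)
open import Relation.Binary.PropositionalEquality using (_≡_; _≢_)
open import Relation.Nullary using (¬_; does)

C-min : ℕ → ℕ → ℕ
C-min C₀ C₁ = C₀ ⊓ C₁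

C-max : ℕ → ℕ → ℕ
C-max C₀ C₁ = C₀ ⊔ C₁

Admissible : ℕ → ℕ → ℕ → ℕ → ℕ → Set
Admissible δ K₁ K₂ C₀ C₁ =
  3 ≤ δ × 1 ≤ K₁ × K₁ ≤ K₂ × K₂ ≤ δ ×
  2 * δ + 2 ≤ C₀ × C₀ ≤ 3 * δ + 2 ×
  2 * δ + 2 ≤ C₁ × C₁ ≤ 3 * δ + 2 ×
  C₀ % 2 ≡ 0 × C₁ % 2 ≡ 1

CaseIII : ℕ → ℕ → ℕ → ℕ → ℕ → Set
CaseIII δ K₁ K₂ C₀ C₁ =
  C-min C₀ C₁ > 2 * δ + K₁ ×
  K₁ + 2 * K₂ + 1 ≥ 2 * δ ×
  3 * K₂ ≥ 2 * δ ×
  (K₁ + 2 * K₂ + 1 ≡ 2 * δ → C-min C₀ C₁ ≥ 2 * δ + K₁ + 2) ×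
  (C-max C₀ C₁ > C-min C₀ C₁ + 1 → C-min C₀ C₁ ≥ 2 * δ + K₂)

Magic : ℕ → ℕ → ℕ → ℕ → ℕ → ℕ → Set
Magic δ K₁ K₂ C₀ C₁ M =
  1 ≤ M × M ≤ δ ×
  K₁ ⊔ ⌈ δ /2⌉ ≤ M ×
  M ≤ K₂ ⊓ ⌊ (C-min C₀ C₁ ∸ δ ∸ 1) /2⌋ ×
  (K₁ + 2 * K₂ + 1 ≡ 2 * δ → M > K₁) ×
  (C-max C₀ C₁ > C-min C₀ C₁ + 1 → C-min C₀ C₁ ≡ 2 * δ + K₂ → M < K₂)

-- the operation x ⊕ y (C = min(C₀,C₁)); for labels in 1..δ the truncated
-- subtraction C - 1 - x - y is exact since C ≥ 2δ+2.
⊕op : (C M x y : ℕ) → ℕ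
⊕op C M x y =
  if does (M <? ∣ x - y ∣) then ∣ x - y ∣
  else (if does (((x + y) ⊓ (C ∸ 1 ∸ x ∸ y)) <? M) then (x + y) ⊓ (C ∸ 1 ∸ x ∸ y)
  else M)

-- δ-edge-labelled cycles: n ≥ 3 edges e₀,…,e_{n-1} in cyclic order,
-- edge eᵢ and e_{i+1 mod n} share a vertex.

record LabelledCycle (δ : ℕ) : Set where
  field
    n       : ℕ
    n≥3     : 3 ≤ n
    label   : Vec ℕ n
    inRange : (i : Fin n) → 1 ≤ lookup label i × lookup label i ≤ δ
open LabelledCycle public

vertices : ∀ {δ} → LabelledCycle δ → ℕ
vertices G = n G

perimeter : ∀ {δ} → LabelledCycle δ → ℕ
perimeter G = sum (toList (label G))

HasDistances : ∀ {δ} → LabelledCycle δ → List ℕ → Set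
HasDistances G ds = toList (label G) ↭ ds

Metric : ∀ {δ} → LabelledCycle δ → Set
Metric G = (i : Fin (n G)) → ¬ (lookup (label G) i > perimeter G ∸ lookup (label G) i)

Neighbouring : (m : ℕ) → Fin m → Fin m → Set
Neighbouring m i j = suc (toℕ i) ≡ toℕ j ⊎ (suc (toℕ i) ≡ m × toℕ j ≡ 0)

HasTension : ∀ {δ} → (C M : ℕ) → LabelledCycle δ → Set
HasTension C M G = ∃[ i ] ∃[ j ] (Neighbouring (n G) i j ×
  ⊕op C M (lookup (label G) i) (lookup (label G) j) ≢ M)

-- Without a tension every pair of neighbouring labels x, y satisfies |x − y| ≤ M, since
-- x ⊕ y = |x − y| as soon as |x − y| > M. In a cycle of length at least four the edges
-- carrying a and b have neighbours r and s such that the four edges are distinct, so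
-- a + b ≤ (M + ℓ r) + (M + ℓ s) ≤ 2 K₂ + Σ xᵢ, contradicting a + b > 2 K₂ + Σ xᵢ.
module Submission where

open import Defs
open import Data.Nat using (ℕ; _+_; _*_; _%_; _>_; _≤_)
open import Data.List using (List; _∷_)
open import Data.Nat.ListAction using (sum)
open import Relation.Binary.PropositionalEquality using (_≡_)

open import Algebra.Properties.CommutativeSemigroup using (x∙yz≈y∙xz)
open import Data.Empty using (⊥-elim)
open import Data.Fin using (Fin; toℕ; fromℕ<; cast)
open import Data.Fin.Permutation using (_⟨$⟩ʳ_; _⟨$⟩ˡ_; inverseˡ)
open import Data.Fin.Properties using (toℕ-fromℕ<; toℕ-injective; toℕ-cast; toℕ<n; 0≢1+n)
import Data.List as List
open import Data.List using ([])
open import Data.List.Properties using (map-cong-local)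
open import Data.List.Relation.Binary.Permutation.Propositional using (_↭_; ↭-sym; ↭⇒↭ₛ)
import Data.List.Relation.Unary.All as All
open import Data.List.Relation.Unary.All using ([]; _∷_)
open import Data.List.Relation.Unary.AllPairs using ([]; _∷_)
open import Data.List.Relation.Unary.Unique.Propositional using (Unique)
open import Data.List.Relation.Unary.Unique.Propositional.Properties using (map⁻)
open import Data.Nat using (zero; suc; _<_; ∣_-_∣; _<?_; z≤n; s≤s; z<s; s<s)
open import Data.Nat.ListAction.Properties using (sum-↭)
open import Data.Nat.Properties
  using ( module ≤-Reasoning; +-commutativeSemigroup; +-comm; +-identityʳ; +-mono-≤; +-monoʳ-≤
        ; +-cancelˡ-≤; *-monoʳ-≤; n<1+n; m<n+m; <-trans; <-cmp; <⇒≢; >⇒≢; <⇒≱; ≮⇒≥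
        ; m≢1+n+m; m≤n⇒m<n∨m≡n; m≤n⊓o⇒m≤n; m≤n+∣m-n∣; ∣-∣-comm )
open import Data.Nat.Tactic.RingSolver using (solve-∀)
open import Data.Product using (_×_; _,_; ∃₂)
open import Data.Sum using (_⊎_; inj₁; inj₂)
open import Data.Vec using (Vec; _∷_; lookup; toList; _[_]≔_)
open import Data.Vec.Properties using (length-toList; lookup∘update′)
open import Function.Base using (_on_)
open import Relation.Binary.Definitions using (tri<; tri≈; tri>)
open import Relation.Binary.PropositionalEquality
  using (_≢_; refl; sym; trans; cong; subst; subst₂; ≢-sym; setoid; module ≡-Reasoning)
open import Relation.Nullary using (yes; no)
open import Relation.Nullary.Decidable using (dec-true)

cast-injective : ∀ {m n} .{e : m ≡ n} {i j : Fin m} → cast e i ≡ cast e j → i ≡ j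
cast-injective {i = i} {j} eq =
  toℕ-injective (trans (sym (toℕ-cast _ i)) (trans (cong toℕ eq) (toℕ-cast _ j)))

module _ {A : Set} where

  open import Data.List.Relation.Binary.Permutation.Setoid (setoid A) using (onIndices)
  open import Data.List.Relation.Binary.Permutation.Setoid.Properties (setoid A)
    using (onIndices-lookup)

  lookup-toList : ∀ {n} (v : Vec A n) (i : Fin (List.length (toList v))) →
                  List.lookup (toList v) i ≡ lookup v (cast (length-toList v) i)
  lookup-toList (x ∷ v) Fin.zero    = refl
  lookup-toList (x ∷ v) (Fin.suc i) = lookup-toList v i

  ↭-positions₂ : ∀ {n} (v : Vec A n) {a b xs} → toList v ↭ a ∷ b ∷ xs →
                 ∃₂ λ p q → p ≢ q × lookup v p ≡ a × lookup v q ≡ b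
  ↭-positions₂ {n} v {a} {b} {xs} v↭ =
    position Fin.zero , position (Fin.suc Fin.zero) , distinct ,
    lookup-position Fin.zero , lookup-position (Fin.suc Fin.zero)
    where
    abxs↭v = ↭⇒↭ₛ (↭-sym v↭)
    π = onIndices abxs↭v
    position : Fin (List.length (a ∷ b ∷ xs)) → Fin n
    position k = cast (length-toList v) (π ⟨$⟩ʳ k)
    lookup-position : ∀ k → lookup v (position k) ≡ List.lookup (a ∷ b ∷ xs) k
    lookup-position k =
      trans (sym (lookup-toList v (π ⟨$⟩ʳ k))) (sym (onIndices-lookup abxs↭v k))
    distinct : position Fin.zero ≢ position (Fin.suc Fin.zero)
    distinct eq = 0≢1+n (begin
      Fin.zero                               ≡⟨ inverseˡ π ⟨
      π ⟨$⟩ˡ (π ⟨$⟩ʳ Fin.zero)               ≡⟨ cong (π ⟨$⟩ˡ_) (cast-injective eq) ⟩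
      π ⟨$⟩ˡ (π ⟨$⟩ʳ Fin.suc Fin.zero)       ≡⟨ inverseˡ π ⟩
      Fin.suc Fin.zero                       ∎)
      where open ≡-Reasoning

sum-[]≔0 : ∀ {n} (v : Vec ℕ n) (i : Fin n) →
           sum (toList v) ≡ lookup v i + sum (toList (v [ i ]≔ 0))
sum-[]≔0 (x ∷ v) Fin.zero    = refl
sum-[]≔0 (x ∷ v) (Fin.suc i) = begin
  x + sum (toList v)                             ≡⟨ cong (x +_) (sum-[]≔0 v i) ⟩
  x + (lookup v i + sum (toList (v [ i ]≔ 0)))   ≡⟨ x∙yz≈y∙xz +-commutativeSemigroup x (lookup v i) _ ⟩
  lookup v i + (x + sum (toList (v [ i ]≔ 0)))   ∎
  where open ≡-Reasoning

sum-lookup-unique≤sum : ∀ {n} (v : Vec ℕ n) {is : List (Fin n)} → Unique is →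
                        sum (List.map (lookup v) is) ≤ sum (toList v)
sum-lookup-unique≤sum v []                      = z≤n
sum-lookup-unique≤sum v {i ∷ is} (i∉is ∷ unique) = begin
  lookup v i + sum (List.map (lookup v) is)   ≡⟨ cong (λ ls → lookup v i + sum ls) agree ⟩
  lookup v i + sum (List.map (lookup v′) is)  ≤⟨ +-monoʳ-≤ _ (sum-lookup-unique≤sum v′ unique) ⟩
  lookup v i + sum (toList v′)                ≡⟨ sum-[]≔0 v i ⟨
  sum (toList v)                              ∎
  where
  open ≤-Reasoning
  v′ = v [ i ]≔ 0
  agree : List.map (lookup v) is ≡ List.map (lookup v′) is
  agree = map-cong-local (All.map (λ i≢j → sym (lookup∘update′ (≢-sym i≢j) v 0)) i∉is)

-- Neighbouring n i j unfolds to CyclicSucc n (toℕ i) (toℕ j).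
CyclicSucc : ℕ → ℕ → ℕ → Set
CyclicSucc n x y = suc x ≡ y ⊎ (suc x ≡ n × y ≡ 0)

Adjacent : ℕ → ℕ → ℕ → Set
Adjacent n x y = CyclicSucc n x y ⊎ CyclicSucc n y x

AdjacentWithin : ℕ → ℕ → ℕ → Set
AdjacentWithin n x y = y < n × Adjacent n x y

record DistinctNeighbours {A : Set} (_~_ : A → A → Set) (p q : A) : Set where
  field
    r s      : A
    p~r      : p ~ r
    q~s      : q ~ s
    distinct : Unique (p ∷ q ∷ r ∷ s ∷ [])

unique₄ : ∀ {A : Set} {a b c d : A} →
          a ≢ b → a ≢ c → a ≢ d → b ≢ c → b ≢ d → c ≢ d → Unique (a ∷ b ∷ c ∷ d ∷ [])
unique₄ a≢b a≢c a≢d b≢c b≢d c≢d =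
  (a≢b ∷ a≢c ∷ a≢d ∷ []) ∷ (b≢c ∷ b≢d ∷ []) ∷ (c≢d ∷ []) ∷ [] ∷ []

DistinctNeighbours-sym : ∀ {A : Set} {_~_ : A → A → Set} {p q} →
                         DistinctNeighbours _~_ p q → DistinctNeighbours _~_ q p
DistinctNeighbours-sym record { r = r ; s = s ; p~r = p~r ; q~s = q~s ; distinct =
  (p≢q ∷ p≢r ∷ p≢s ∷ []) ∷ (q≢r ∷ q≢s ∷ []) ∷ (r≢s ∷ []) ∷ [] ∷ [] } =
  record { r = s ; s = r ; p~r = q~s ; q~s = p~r ;
           distinct = unique₄ (≢-sym p≢q) q≢s q≢r p≢s p≢r (≢-sym r≢s) }

module _ (k : ℕ) where

  private
    _~_ = AdjacentWithin (4 + k)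

  distinct-neighbours-consecutive : ∀ i → suc i < 4 + k → DistinctNeighbours _~_ i (suc i)
  distinct-neighbours-consecutive zero _ = record
    { r = 3 + k ; s = 2
    ; p~r = n<1+n _ , inj₂ (inj₂ (refl , refl))
    ; q~s = s<s (s<s z<s) , inj₁ (inj₁ refl)
    ; distinct = unique₄ (λ ()) (λ ()) (λ ()) (λ ()) (λ ()) (λ ()) }
  distinct-neighbours-consecutive (suc i) 2+i<n with m≤n⇒m<n∨m≡n 2+i<n
  ... | inj₁ 3+i<n = record
    { r = i ; s = 3 + i
    ; p~r = <-trans (m<n+m i {3} z<s) 3+i<n , inj₂ (inj₁ refl)
    ; q~s = 3+i<n , inj₁ (inj₁ refl)
    ; distinct = unique₄ (m≢1+n+m (suc i) {0}) (≢-sym (m≢1+n+m i {0})) (m≢1+n+m (suc i) {1})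
                         (≢-sym (m≢1+n+m i {1})) (m≢1+n+m (2 + i) {0}) (m≢1+n+m i {2}) }
  ... | inj₂ refl = record
    { r = suc k ; s = 0
    ; p~r = m<n+m (suc k) {3} z<s , inj₂ (inj₁ refl)
    ; q~s = z<s , inj₁ (inj₂ (refl , refl))
    ; distinct = unique₄ (m≢1+n+m (2 + k) {0}) (≢-sym (m≢1+n+m (suc k) {0})) (λ ())
                         (≢-sym (m≢1+n+m (suc k) {1})) (λ ()) (λ ()) }

  distinct-neighbours-separated : ∀ {i j} → suc i < j → j < 4 + k → DistinctNeighbours _~_ i j
  distinct-neighbours-separated {i} {j} 1+i<j j<n with m≤n⇒m<n∨m≡n j<n
  ... | inj₁ 1+j<n = record
    { r = suc i ; s = suc j
    ; p~r = <-trans 1+i<j j<n , inj₁ (inj₁ refl)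
    ; q~s = 1+j<n , inj₁ (inj₁ refl)
    ; distinct = unique₄ (<⇒≢ i<j) (m≢1+n+m i {0}) (<⇒≢ (<-trans i<j (n<1+n j)))
                         (>⇒≢ 1+i<j) (m≢1+n+m j {0}) (<⇒≢ (s<s i<j)) }
    where i<j = <-trans (n<1+n i) 1+i<j
  distinct-neighbours-separated {zero} 1+i<j j<n | inj₂ refl = record
    { r = 1 ; s = 2 + k
    ; p~r = s<s z<s , inj₁ (inj₁ refl)
    ; q~s = m<n+m (2 + k) {2} z<s , inj₂ (inj₁ refl)
    ; distinct = unique₄ (λ ()) (λ ()) (λ ()) (λ ()) (≢-sym (m≢1+n+m (2 + k) {0})) (λ ()) }
  distinct-neighbours-separated {suc i} 1+i<j j<n | inj₂ refl = record
    { r = 2 + i ; s = 0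
    ; p~r = <-trans 1+i<j j<n , inj₁ (inj₁ refl)
    ; q~s = z<s , inj₁ (inj₂ (refl , refl))
    ; distinct = unique₄ (<⇒≢ (<-trans (n<1+n _) 1+i<j)) (m≢1+n+m (suc i) {0}) (λ ())
                         (>⇒≢ 1+i<j) (λ ()) (λ ()) }

  distinct-neighbours-< : ∀ {i j} → i < j → j < 4 + k → DistinctNeighbours _~_ i j
  distinct-neighbours-< {i} i<j j<n with m≤n⇒m<n∨m≡n i<j
  ... | inj₁ 1+i<j = distinct-neighbours-separated 1+i<j j<n
  ... | inj₂ refl  = distinct-neighbours-consecutive i j<n

module _ {n : ℕ} where

  DistinctNeighbours-toFin : ∀ {p q : Fin n} →
                             DistinctNeighbours (AdjacentWithin n) (toℕ p) (toℕ q) →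
                             DistinctNeighbours (Adjacent n on toℕ) p q
  DistinctNeighbours-toFin {p} {q}
    record { r = r ; s = s ; p~r = r<n , p~r ; q~s = s<n , q~s ; distinct = u } =
    record { r = fromℕ< r<n ; s = fromℕ< s<n
           ; p~r = subst (Adjacent n (toℕ p)) (sym (toℕ-fromℕ< r<n)) p~r
           ; q~s = subst (Adjacent n (toℕ q)) (sym (toℕ-fromℕ< s<n)) q~s
           ; distinct = map⁻ (subst₂ (λ r′ s′ → Unique (toℕ p ∷ toℕ q ∷ r′ ∷ s′ ∷ []))
                                     (sym (toℕ-fromℕ< r<n)) (sym (toℕ-fromℕ< s<n)) u) }

distinct-neighbours : ∀ {n} → 4 ≤ n → {p q : Fin n} → p ≢ q →
                      DistinctNeighbours (Adjacent n on toℕ) p q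
distinct-neighbours {suc (suc (suc (suc k)))} (s≤s (s≤s (s≤s (s≤s _)))) {p} {q} p≢q
  with <-cmp (toℕ p) (toℕ q)
... | tri< p<q _ _ = DistinctNeighbours-toFin (distinct-neighbours-< k p<q (toℕ<n q))
... | tri≈ _ p≡q _ = ⊥-elim (p≢q (toℕ-injective p≡q))
... | tri> _ _ q<p =
  DistinctNeighbours-sym (DistinctNeighbours-toFin (distinct-neighbours-< k q<p (toℕ<n p)))

⊕op-far : ∀ C M x y → M < ∣ x - y ∣ → ⊕op C M x y ≡ ∣ x - y ∣
⊕op-far C M x y M<∣x-y∣ rewrite dec-true (M <? ∣ x - y ∣) M<∣x-y∣ = refl

far⇒⊕op≢M : ∀ C M x y → M < ∣ x - y ∣ → ⊕op C M x y ≢ M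
far⇒⊕op≢M C M x y M<∣x-y∣ x⊕y≡M = <⇒≢ M<∣x-y∣ (trans (sym x⊕y≡M) (⊕op-far C M x y M<∣x-y∣))

module _ {δ : ℕ} (C M : ℕ) (G : LabelledCycle δ) where

  private
    ℓ : Fin (n G) → ℕ
    ℓ = lookup (label G)

  tension-or-close : ∀ {i j} → (Adjacent (n G) on toℕ) i j → HasTension C M G ⊎ ℓ i ≤ M + ℓ j
  tension-or-close {i} {j} i~j with M <? ∣ ℓ i - ℓ j ∣ | i~j
  ... | yes far | inj₁ i→j = inj₁ (i , j , i→j , far⇒⊕op≢M C M (ℓ i) (ℓ j) far)
  ... | yes far | inj₂ j→i =
    inj₁ (j , i , j→i , far⇒⊕op≢M C M (ℓ j) (ℓ i) (subst (M <_) (∣-∣-comm (ℓ i) (ℓ j)) far))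
  ... | no ¬far | _ = inj₂ (begin
    ℓ i                  ≤⟨ m≤n+∣m-n∣ (ℓ i) (ℓ j) ⟩
    ℓ j + ∣ ℓ i - ℓ j ∣  ≤⟨ +-monoʳ-≤ (ℓ j) (≮⇒≥ ¬far) ⟩
    ℓ j + M              ≡⟨ +-comm (ℓ j) M ⟩
    M + ℓ j              ∎)
    where open ≤-Reasoning

  tension-or-bounded : ∀ {p q r s} →
                       (Adjacent (n G) on toℕ) p r → (Adjacent (n G) on toℕ) q s →
                       HasTension C M G ⊎ ℓ p + ℓ q ≤ 2 * M + (ℓ r + ℓ s)
  tension-or-bounded {p} {q} {r} {s} p~r q~s with tension-or-close p~r | tension-or-close q~s
  ... | inj₁ tension | _            = inj₁ tension
  ... | inj₂ _       | inj₁ tension = inj₁ tension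
  ... | inj₂ p≤M+r   | inj₂ q≤M+s   = inj₂ (begin
    ℓ p + ℓ q                ≤⟨ +-mono-≤ p≤M+r q≤M+s ⟩
    (M + ℓ r) + (M + ℓ s)    ≡⟨ pair-rearrange M (ℓ r) (ℓ s) ⟩
    2 * M + (ℓ r + ℓ s)      ∎)
    where
    open ≤-Reasoning
    pair-rearrange : ∀ m x y → (m + x) + (m + y) ≡ 2 * m + (x + y)
    pair-rearrange = solve-∀

  other-labels≤ : ∀ {p q r s xs} → Unique (p ∷ q ∷ r ∷ s ∷ []) →
                  HasDistances G (ℓ p ∷ ℓ q ∷ xs) → ℓ r + ℓ s ≤ sum xs
  other-labels≤ {p} {q} {r} {s} {xs} distinct G∼pqxs =
    +-cancelˡ-≤ (ℓ q) _ _ (+-cancelˡ-≤ (ℓ p) _ _ (begin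
      ℓ p + (ℓ q + (ℓ r + ℓ s))              ≡⟨ cong (λ x → ℓ p + (ℓ q + (ℓ r + x))) (+-identityʳ _) ⟨
      sum (List.map ℓ (p ∷ q ∷ r ∷ s ∷ []))  ≤⟨ sum-lookup-unique≤sum (label G) distinct ⟩
      perimeter G                            ≡⟨ sum-↭ G∼pqxs ⟩
      ℓ p + (ℓ q + sum xs)                   ∎))
    where open ≤-Reasoning

mainTheorem7 : (δ K₁ K₂ C₀ C₁ M : ℕ) →
    Admissible δ K₁ K₂ C₀ C₁ → CaseIII δ K₁ K₂ C₀ C₁ → Magic δ K₁ K₂ C₀ C₁ M →
    (G : LabelledCycle δ) → Metric G → perimeter G % 2 ≡ 1 →
    (a b : ℕ) (xs : List ℕ) → HasDistances G (a ∷ b ∷ xs) →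
    a + b > 2 * K₂ + sum xs →
    4 ≤ vertices G →
    HasTension (C-min C₀ C₁) M G
mainTheorem7 δ K₁ K₂ C₀ C₁ M _ _ (_ , _ , _ , M≤K₂⊓ , _) G _ _ a b xs G∼abxs a+b>2K₂+Σxs 4≤n
  with ↭-positions₂ (label G) G∼abxs
... | p , q , p≢q , refl , refl with distinct-neighbours 4≤n p≢q
... | record { r = r ; s = s ; p~r = p~r ; q~s = q~s ; distinct = distinct }
  with tension-or-bounded (C-min C₀ C₁) M G p~r q~s
... | inj₁ tension = tension
... | inj₂ bounded = ⊥-elim (<⇒≱ a+b>2K₂+Σxs (begin
  a + b                  ≤⟨ bounded ⟩
  2 * M + (ℓ r + ℓ s)    ≤⟨ +-mono-≤ (*-monoʳ-≤ 2 (m≤n⊓o⇒m≤n K₂ _ M≤K₂⊓))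
                                     (other-labels≤ (C-min C₀ C₁) M G distinct G∼abxs) ⟩
  2 * K₂ + sum xs        ∎))
  where
  open ≤-Reasoning
  ℓ = lookup (label G)
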